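{- Let $p,q$ be two distinct prime numbers, and let $k$ be the positive integer such that $p^{k-1}\,\|\,(q-1)$ (i.e. $p^{k-1}\mid q-1$ and $p^{k}\nmid q-1$). Let $a$ be a positive integer. Then $p$ divides $\sigma(q^{2a})$ if and only if $2a+1\equiv 0\pmod f$, where $f$ is the smallest odd positive integer greater than $1$ such that $q^{f}\equiv 1\pmod{p^{k}}$.
   Context: $\sigma(n)$ denotes the sum of the positive divisors of $n$; thus $\sigma(q^{2a})=1+q+\dots+q^{2a}$. The notation $p^{j}\,\|\,m$ means $p^j\mid m$ and $p^{j+1}\nmid m$. -}

module Defs where

open import Data.Nat using (ℕ; suc; _+_; _*_; _∸_; _^_; _<_; _≤_)
open import Data.Nat.Divisibility using (_∣_; _∣?_)
open import Data.List using (filter; upTo; map)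
open import Data.Nat.ListAction using (sum)
open import Data.Product using (∃)
open import Relation.Binary.PropositionalEquality using (_≡_)

σ : ℕ → ℕ
σ n = sum (filter (_∣? n) (map suc (upTo n)))

Odd : ℕ → Set
Odd g = ∃ λ m → g ≡ 1 + 2 * m

IsLeastOddOrder : ℕ → ℕ → ℕ → ℕ → Set
IsLeastOddOrder p q k f =
  Odd f × 1 < f × (p ^ k ∣ q ^ f ∸ 1) ×
  (∀ g → Odd g → 1 < g → p ^ k ∣ q ^ g ∸ 1 → f ≤ g)
  where open import Data.Product using (_×_)

-- Since (q − 1)·σ(q^n) = q^(n+1) − 1 and p^(k−1) is the exact power of p dividing q − 1,
-- p ∣ σ(q^(2a)) holds iff p^k ∣ q^(2a+1) − 1. The exponents e with p^k ∣ q^e − 1 are closed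
-- under gcd (Bézout), and gcd(2a+1, f) is odd and, as p^k ∤ q − 1, different from 1; by the
-- minimality of f it equals f, so p^k ∣ q^(2a+1) − 1 iff f ∣ 2a+1.
module Submission where

open import Defs
open import Data.Nat using (ℕ; suc; _+_; _*_; _∸_; _^_; _<_; _≤_)
open import Data.Nat.Divisibility using (_∣_)
open import Data.Nat.Primality using (Prime)
open import Data.Product using (_×_)
open import Relation.Nullary using (¬_)
open import Relation.Binary.PropositionalEquality using (_≢_)

open import Data.Nat
  using (zero; pred; z≤n; s≤s; z<s; _≤′_; ≤′-refl; ≤′-step; NonZero; >-nonZero; nonTrivial⇒n>1)
open import Data.Nat.Properties
open import Data.Nat.Divisibility
open import Data.Nat.Primality using (prime⇒nonZero; prime⇒nonTrivial; prime⇒irreducible; euclidsLemma)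
open import Data.Nat.Coprimality using (Coprime; coprime-divisor)
open import Data.Nat.GCD using (gcd; gcd[m,n]∣m; gcd[m,n]∣n; gcd-GCD; module Bézout)
open import Data.Nat.ListAction using (sum)
open import Data.Nat.ListAction.Properties using (sum-++)
open import Data.Nat.Solver using (module +-*-Solver)
open import Data.List using ([]; _∷_; _∷ʳ_; _++_; filter; upTo; map)
open import Data.List.Properties using (upTo-∷ʳ; map-++; filter-++; filter-accept; filter-reject)
open import Data.Product using (_,_)
open import Data.Sum using (_⊎_; inj₁; inj₂)
open import Function using (_∘_)
open import Function.Bundles using (_⇔_; mk⇔; Equivalence)
open import Function.Properties.Equivalence using () renaming (trans to ⇔-trans; sym to ⇔-sym)
open import Relation.Nullary using (yes; no; contradiction)
open import Relation.Binary.PropositionalEquality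
  using (_≡_; refl; sym; trans; cong; subst; subst₂; module ≡-Reasoning)

open ≡-Reasoning

geometricSum : ℕ → ℕ → ℕ
geometricSum x zero    = 1
geometricSum x (suc n) = geometricSum x n + x ^ suc n

[x∸1]*geometricSum≡x^[1+n]∸1 : ∀ x n → (x ∸ 1) * geometricSum x n ≡ x ^ suc n ∸ 1
[x∸1]*geometricSum≡x^[1+n]∸1 zero    n = refl
[x∸1]*geometricSum≡x^[1+n]∸1 (suc r) n = trans (sym (m+n∸n≡m _ 1)) (cong (_∸ 1) (telescope n))
  where
  open +-*-Solver using (solve; _:+_; _:*_; con; _:=_)
  telescope : ∀ n → r * geometricSum (suc r) n + 1 ≡ suc r ^ suc n
  telescope zero    = +-comm (r * 1) 1
  telescope (suc n) = begin
    r * (G + X) + 1     ≡⟨ solve 3 (λ r g x → r :* (g :+ x) :+ con 1 := (r :* g :+ con 1) :+ r :* x) refl r G X ⟩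
    (r * G + 1) + r * X ≡⟨ cong (_+ r * X) (telescope n) ⟩
    X + r * X           ∎
    where
    G = geometricSum (suc r) n
    X = suc r ^ suc n

divisorSum : ℕ → ℕ → ℕ
divisorSum n m = sum (filter (_∣? n) (map suc (upTo m)))

divisorSum-suc : ∀ n m → divisorSum n (suc m) ≡ divisorSum n m + sum (filter (_∣? n) (suc m ∷ []))
divisorSum-suc n m = begin
  sum (filter (_∣? n) (map suc (upTo (suc m))))            ≡⟨ cong (sum ∘ filter (_∣? n) ∘ map suc) (upTo-∷ʳ m) ⟨
  sum (filter (_∣? n) (map suc (upTo m ∷ʳ m)))             ≡⟨ cong (sum ∘ filter (_∣? n)) (map-++ suc (upTo m) (m ∷ [])) ⟩
  sum (filter (_∣? n) (map suc (upTo m) ∷ʳ suc m))         ≡⟨ cong sum (filter-++ (_∣? n) (map suc (upTo m)) (suc m ∷ [])) ⟩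
  sum (filter (_∣? n) (map suc (upTo m)) ++ filter (_∣? n) (suc m ∷ []))
                                                           ≡⟨ sum-++ (filter (_∣? n) (map suc (upTo m))) _ ⟩
  divisorSum n m + sum (filter (_∣? n) (suc m ∷ []))       ∎

divisorSum-∣ : ∀ n m → suc m ∣ n → divisorSum n (suc m) ≡ divisorSum n m + suc m
divisorSum-∣ n m m+1∣n = begin
  divisorSum n (suc m)                               ≡⟨ divisorSum-suc n m ⟩
  divisorSum n m + sum (filter (_∣? n) (suc m ∷ [])) ≡⟨ cong (λ xs → divisorSum n m + sum xs) (filter-accept (_∣? n) m+1∣n) ⟩
  divisorSum n m + (suc m + 0)                       ≡⟨ cong (divisorSum n m +_) (+-identityʳ (suc m)) ⟩
  divisorSum n m + suc m                             ∎

divisorSum-∤ : ∀ n m → suc m ∤ n → divisorSum n (suc m) ≡ divisorSum n m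
divisorSum-∤ n m m+1∤n = begin
  divisorSum n (suc m)                               ≡⟨ divisorSum-suc n m ⟩
  divisorSum n m + sum (filter (_∣? n) (suc m ∷ [])) ≡⟨ cong (λ xs → divisorSum n m + sum xs) (filter-reject (_∣? n) m+1∤n) ⟩
  divisorSum n m + 0                                 ≡⟨ +-identityʳ (divisorSum n m) ⟩
  divisorSum n m                                     ∎

σ≡divisorSum[pred]+id : ∀ n .{{_ : NonZero n}} → σ n ≡ divisorSum n (pred n) + n
σ≡divisorSum[pred]+id (suc m) = divisorSum-∣ (suc m) m ∣-refl

divisorSum-≥ : ∀ {n m} .{{_ : NonZero n}} → n ≤′ m → divisorSum n m ≡ σ n
divisorSum-≥ ≤′-refl                   = refl
divisorSum-≥ {n} (≤′-step {m} n≤′m) =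
  trans (divisorSum-∤ n m (>⇒∤ (s≤s (≤′⇒≤ n≤′m)))) (divisorSum-≥ n≤′m)

divisorSum-cong : ∀ {n n′} m → (∀ {d} → d < m → suc d ∣ n ⇔ suc d ∣ n′) →
                  divisorSum n m ≡ divisorSum n′ m
divisorSum-cong zero _ = refl
divisorSum-cong {n} {n′} (suc m) ∣⇔∣ with suc m ∣? n
... | yes m+1∣n = begin
  divisorSum n (suc m)     ≡⟨ divisorSum-∣ n m m+1∣n ⟩
  divisorSum n m + suc m   ≡⟨ cong (_+ suc m) (divisorSum-cong m (∣⇔∣ ∘ m<n⇒m<1+n)) ⟩
  divisorSum n′ m + suc m  ≡⟨ divisorSum-∣ n′ m (Equivalence.to (∣⇔∣ ≤-refl) m+1∣n) ⟨
  divisorSum n′ (suc m)    ∎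
... | no m+1∤n = begin
  divisorSum n (suc m)     ≡⟨ divisorSum-∤ n m m+1∤n ⟩
  divisorSum n m           ≡⟨ divisorSum-cong m (∣⇔∣ ∘ m<n⇒m<1+n) ⟩
  divisorSum n′ m          ≡⟨ divisorSum-∤ n′ m (m+1∤n ∘ Equivalence.from (∣⇔∣ ≤-refl)) ⟨
  divisorSum n′ (suc m)    ∎

prime∤⇒coprime : ∀ {p n} → Prime p → p ∤ n → Coprime n p
prime∤⇒coprime p-prime p∤n (d∣n , d∣p) with prime⇒irreducible p-prime d∣p
... | inj₁ d≡1 = d≡1
... | inj₂ d≡p = contradiction (subst (_∣ _) d≡p d∣n) p∤n

∣q^[1+n]⇒∣q^n : ∀ {q} → Prime q → ∀ n {d} → d ∣ q ^ suc n → d < q ^ suc n → d ∣ q ^ n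
∣q^[1+n]⇒∣q^n {q} q-prime n {d} d∣q^[1+n] d<q^[1+n] with q ∣? d
... | no q∤d = coprime-divisor (prime∤⇒coprime q-prime q∤d) d∣q^[1+n]
... | yes (divides e refl) = lift n
  (*-cancelʳ-∣ q (subst (e * q ∣_) (*-comm q (q ^ n)) d∣q^[1+n]))
  (*-cancelʳ-< q e (q ^ n) (subst (e * q <_) (*-comm q (q ^ n)) d<q^[1+n]))
  where
  instance _ = prime⇒nonZero q-prime
  lift : ∀ n → e ∣ q ^ n → e < q ^ n → e * q ∣ q ^ n
  lift zero    e∣1 e<1 = contradiction (∣1⇒≡1 e∣1) (<⇒≢ e<1)
  lift (suc m) e∣q^[1+m] e<q^[1+m] =
    subst (e * q ∣_) (*-comm (q ^ m) q) (*-monoˡ-∣ q (∣q^[1+n]⇒∣q^n q-prime m e∣q^[1+m] e<q^[1+m]))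

σ[q^[1+n]] : ∀ {q} → Prime q → ∀ n → σ (q ^ suc n) ≡ σ (q ^ n) + q ^ suc n
σ[q^[1+n]] {q} q-prime n = begin
  σ Q                              ≡⟨ σ≡divisorSum[pred]+id Q ⟩
  divisorSum Q (pred Q) + Q        ≡⟨ cong (_+ Q) (divisorSum-cong (pred Q) same-divisors) ⟩
  divisorSum (q ^ n) (pred Q) + Q  ≡⟨ cong (_+ Q) (divisorSum-≥ (≤⇒≤′ (<⇒≤pred q^n<Q))) ⟩
  σ (q ^ n) + Q                    ∎
  where
  instance _ = prime⇒nonZero q-prime
  instance _ = m^n≢0 q n
  instance _ = m^n≢0 q (suc n)
  Q = q ^ suc n
  q^n<Q : q ^ n < Q
  q^n<Q = ^-monoʳ-< q (nonTrivial⇒n>1 q {{prime⇒nonTrivial q-prime}}) (n<1+n n)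
  same-divisors : ∀ {d} → d < pred Q → suc d ∣ Q ⇔ suc d ∣ q ^ n
  same-divisors d<pred[Q] =
    mk⇔ (λ d∣Q → ∣q^[1+n]⇒∣q^n q-prime n d∣Q (m≤pred[n]⇒suc[m]≤n d<pred[Q])) (∣n⇒∣m*n q)

σ[q^n]≡geometricSum : ∀ {q} → Prime q → ∀ n → σ (q ^ n) ≡ geometricSum q n
σ[q^n]≡geometricSum q-prime zero    = refl
σ[q^n]≡geometricSum {q} q-prime (suc n) =
  trans (σ[q^[1+n]] q-prime n) (cong (_+ q ^ suc n) (σ[q^n]≡geometricSum q-prime n))

p^[1+j]∣r*x⇔p∣x : ∀ {p j r x} → Prime p → p ^ j ∣ r → ¬ (p ^ suc j ∣ r) → p ^ suc j ∣ r * x ⇔ p ∣ x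
p^[1+j]∣r*x⇔p∣x {p} {j} {r} {x} p-prime pʲ∣r@(divides c r≡c*pʲ) pʲ⁺¹∤r = mk⇔ to from
  where
  instance _ = prime⇒nonZero p-prime
  instance _ = m^n≢0 p j
  r*x≡pʲ*[c*x] : r * x ≡ p ^ j * (c * x)
  r*x≡pʲ*[c*x] = begin
    r * x           ≡⟨ cong (_* x) r≡c*pʲ ⟩
    c * p ^ j * x   ≡⟨ cong (_* x) (*-comm c (p ^ j)) ⟩
    p ^ j * c * x   ≡⟨ *-assoc (p ^ j) c x ⟩
    p ^ j * (c * x) ∎
  p∤c : p ∤ c
  p∤c p∣c = pʲ⁺¹∤r (subst (p ^ suc j ∣_) (sym r≡c*pʲ) (*-monoˡ-∣ (p ^ j) p∣c))
  to : p ^ suc j ∣ r * x → p ∣ x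
  to pʲ⁺¹∣r*x with euclidsLemma c x p-prime
    (*-cancelˡ-∣ (p ^ j) (subst₂ _∣_ (*-comm p (p ^ j)) r*x≡pʲ*[c*x] pʲ⁺¹∣r*x))
  ... | inj₁ p∣c = contradiction p∣c p∤c
  ... | inj₂ p∣x = p∣x
  from : p ∣ x → p ^ suc j ∣ r * x
  from p∣x = subst (_∣ r * x) (*-comm (p ^ j) p) (*-pres-∣ pʲ∣r p∣x)

p∣σ[q^n]⇔p^[1+j]∣q^[1+n]∸1 : ∀ {p q j} → Prime p → Prime q → p ^ j ∣ q ∸ 1 → ¬ (p ^ suc j ∣ q ∸ 1) →
                              ∀ n → p ∣ σ (q ^ n) ⇔ p ^ suc j ∣ q ^ suc n ∸ 1
p∣σ[q^n]⇔p^[1+j]∣q^[1+n]∸1 {_} {q} {j} p-prime q-prime pʲ∣q∸1 pʲ⁺¹∤q∸1 n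
  rewrite σ[q^n]≡geometricSum q-prime n | sym ([x∸1]*geometricSum≡x^[1+n]∸1 q n)
  = ⇔-sym (p^[1+j]∣r*x⇔p∣x {j = j} p-prime pʲ∣q∸1 pʲ⁺¹∤q∸1)

x∸1∣x^n∸1 : ∀ x n → x ∸ 1 ∣ x ^ n ∸ 1
x∸1∣x^n∸1 x zero    = (x ∸ 1) ∣0
x∸1∣x^n∸1 x (suc n) = subst (x ∸ 1 ∣_) ([x∸1]*geometricSum≡x^[1+n]∸1 x n) (m∣m*n (geometricSum x n))

∣x^n∸1⇒∣x^[c*n]∸1 : ∀ {m} x n c → m ∣ x ^ n ∸ 1 → m ∣ x ^ (c * n) ∸ 1
∣x^n∸1⇒∣x^[c*n]∸1 x n c m∣x^n∸1 = ∣-trans m∣x^n∸1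
  (subst (x ^ n ∸ 1 ∣_) (cong (_∸ 1) (trans (^-*-assoc x n c) (cong (x ^_) (*-comm n c))))
         (x∸1∣x^n∸1 (x ^ n) c))

x^[i+j]∸1≡x^i*[x^j∸1]+[x^i∸1] : ∀ x .{{_ : NonZero x}} i j →
                                 x ^ (i + j) ∸ 1 ≡ x ^ i * (x ^ j ∸ 1) + (x ^ i ∸ 1)
x^[i+j]∸1≡x^i*[x^j∸1]+[x^i∸1] x i j = sym (begin
  x ^ i * (x ^ j ∸ 1) + (x ^ i ∸ 1)         ≡⟨ cong (_+ (x ^ i ∸ 1)) (*-distribˡ-∸ (x ^ i) (x ^ j) 1) ⟩
  (x ^ i * x ^ j ∸ x ^ i * 1) + (x ^ i ∸ 1) ≡⟨ cong (λ y → (x ^ i * x ^ j ∸ y) + (x ^ i ∸ 1)) (*-identityʳ (x ^ i)) ⟩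
  (x ^ i * x ^ j ∸ x ^ i) + (x ^ i ∸ 1)     ≡⟨ +-∸-assoc _ (m^n>0 x i) ⟨
  (x ^ i * x ^ j ∸ x ^ i) + x ^ i ∸ 1       ≡⟨ cong (_∸ 1) (m∸n+n≡m (m≤m*n (x ^ i) (x ^ j))) ⟩
  x ^ i * x ^ j ∸ 1                         ≡⟨ cong (_∸ 1) (^-distribˡ-+-* x i j) ⟨
  x ^ (i + j) ∸ 1                           ∎)
  where instance _ = m^n≢0 x j

∣x^[i+j]∸1⇒∣x^j∸1⇒∣x^i∸1 : ∀ {m} x .{{_ : NonZero x}} i j →
                            m ∣ x ^ (i + j) ∸ 1 → m ∣ x ^ j ∸ 1 → m ∣ x ^ i ∸ 1
∣x^[i+j]∸1⇒∣x^j∸1⇒∣x^i∸1 {m} x i j m∣x^[i+j]∸1 m∣x^j∸1 = ∣m+n∣m⇒∣n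
  (subst (m ∣_) (x^[i+j]∸1≡x^i*[x^j∸1]+[x^i∸1] x i j) m∣x^[i+j]∸1)
  (∣n⇒∣m*n (x ^ i) m∣x^j∸1)

∣x^i∸1⇒∣x^j∸1⇒∣x^gcd∸1 : ∀ {m} x .{{_ : NonZero x}} i j →
                          m ∣ x ^ i ∸ 1 → m ∣ x ^ j ∸ 1 → m ∣ x ^ gcd i j ∸ 1
∣x^i∸1⇒∣x^j∸1⇒∣x^gcd∸1 {m} x i j m∣x^i∸1 m∣x^j∸1 with Bézout.identity (gcd-GCD i j)
... | Bézout.+- a b g+b*j≡a*i = ∣x^[i+j]∸1⇒∣x^j∸1⇒∣x^i∸1 x (gcd i j) (b * j)
  (subst (λ e → m ∣ x ^ e ∸ 1) (sym g+b*j≡a*i) (∣x^n∸1⇒∣x^[c*n]∸1 x i a m∣x^i∸1))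
  (∣x^n∸1⇒∣x^[c*n]∸1 x j b m∣x^j∸1)
... | Bézout.-+ a b g+a*i≡b*j = ∣x^[i+j]∸1⇒∣x^j∸1⇒∣x^i∸1 x (gcd i j) (a * i)
  (subst (λ e → m ∣ x ^ e ∸ 1) (sym g+a*i≡b*j) (∣x^n∸1⇒∣x^[c*n]∸1 x j b m∣x^j∸1))
  (∣x^n∸1⇒∣x^[c*n]∸1 x i a m∣x^i∸1)

odd⊎even : ∀ n → Odd n ⊎ 2 ∣ n
odd⊎even zero          = inj₂ (2 ∣0)
odd⊎even (suc zero)    = inj₁ (0 , refl)
odd⊎even (suc (suc n)) with odd⊎even n
... | inj₁ (m , n≡1+2m) = inj₁ (suc m , trans (cong (2 +_) n≡1+2m) (cong suc (sym (*-suc 2 m))))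
... | inj₂ 2∣n          = inj₂ (∣m∣n⇒∣m+n (∣-refl {2}) 2∣n)

odd⇒¬even : ∀ {n} → Odd n → 2 ∤ n
odd⇒¬even (m , refl) 2∣1+2m with ∣1⇒≡1 (∣m+n∣m⇒∣n (subst (2 ∣_) (+-comm 1 (2 * m)) 2∣1+2m) (m∣m*n m))
... | ()

∣-odd⇒odd : ∀ {d n} → d ∣ n → Odd n → Odd d
∣-odd⇒odd {d} d∣n n-odd with odd⊎even d
... | inj₁ d-odd = d-odd
... | inj₂ 2∣d   = contradiction (∣-trans 2∣d d∣n) (odd⇒¬even n-odd)

leastOddOrder∣⇔ : ∀ {p q k f n} .{{_ : NonZero q}} → IsLeastOddOrder p q k f → ¬ (p ^ k ∣ q ∸ 1) →
                  Odd n → p ^ k ∣ q ^ n ∸ 1 ⇔ f ∣ n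
leastOddOrder∣⇔ {p} {q} {k} {f} {n} (_ , 1<f , pᵏ∣q^f∸1 , f-least) pᵏ∤q∸1 n-odd = mk⇔ to from
  where
  from : f ∣ n → p ^ k ∣ q ^ n ∸ 1
  from (divides c n≡c*f) =
    subst (λ e → p ^ k ∣ q ^ e ∸ 1) (sym n≡c*f) (∣x^n∸1⇒∣x^[c*n]∸1 q f c pᵏ∣q^f∸1)
  to : p ^ k ∣ q ^ n ∸ 1 → f ∣ n
  to pᵏ∣q^n∸1 = subst (_∣ n) g≡f (gcd[m,n]∣m n f)
    where
    instance _ = >-nonZero (<-trans z<s 1<f)
    g = gcd n f
    pᵏ∣q^g∸1 : p ^ k ∣ q ^ g ∸ 1
    pᵏ∣q^g∸1 = ∣x^i∸1⇒∣x^j∸1⇒∣x^gcd∸1 q n f pᵏ∣q^n∸1 pᵏ∣q^f∸1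
    g-odd : Odd g
    g-odd = ∣-odd⇒odd (gcd[m,n]∣m n f) n-odd
    1<g : 1 < g
    1<g with g-odd
    ... | zero  , g≡1     = contradiction
      (subst (λ e → p ^ k ∣ e ∸ 1) (^-identityʳ q) (subst (λ e → p ^ k ∣ q ^ e ∸ 1) g≡1 pᵏ∣q^g∸1)) pᵏ∤q∸1
    ... | suc m , g≡3+2m = subst (1 <_) (sym g≡3+2m) (s≤s (s≤s z≤n))
    g≡f : g ≡ f
    g≡f = ≤-antisym (∣⇒≤ (gcd[m,n]∣n n f)) (f-least g g-odd 1<g pᵏ∣q^g∸1)

theorem1p3 : (p q k a f : ℕ) → Prime p → Prime q → p ≢ q →
    1 ≤ k → p ^ (k ∸ 1) ∣ q ∸ 1 → ¬ (p ^ k ∣ q ∸ 1) →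
    1 ≤ a → IsLeastOddOrder p q k f →
    ((p ∣ σ (q ^ (2 * a)) → f ∣ 2 * a + 1) × (f ∣ 2 * a + 1 → p ∣ σ (q ^ (2 * a))))
theorem1p3 p q (suc j) a f p-prime q-prime _ _ pʲ∣q∸1 pʲ⁺¹∤q∸1 _ order
  rewrite +-comm (2 * a) 1 = Equivalence.to σ⇔f , Equivalence.from σ⇔f
  where
  instance _ = prime⇒nonZero q-prime
  σ⇔f : p ∣ σ (q ^ (2 * a)) ⇔ f ∣ suc (2 * a)
  σ⇔f = ⇔-trans (p∣σ[q^n]⇔p^[1+j]∣q^[1+n]∸1 {j = j} p-prime q-prime pʲ∣q∸1 pʲ⁺¹∤q∸1 (2 * a))
                (leastOddOrder∣⇔ {p} {q} {suc j} {f} order pʲ⁺¹∤q∸1 (a , refl))
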